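{- For all integers $k\ge1$, $m\ge0$ and $0\le l<k$, \[ \mathrm{mp}_{321,132}(km+l,k)=\binom{m}{2}+1. \]
   Context: A permutation $\pi$ of $[n]$ is mod-$k$-alternating if $\pi(i)\equiv i\pmod k$ for all $i$. A permutation contains a pattern $\sigma$ if some subsequence of its one-line notation is order-isomorphic to $\sigma$, and avoids it otherwise. $\mathrm{mp}_{\sigma,\tau}(n,k)$ is the number of mod-$k$-alternating permutations of $[n]$ avoiding both $\sigma$ and $\tau$. -}

module Defs where

open import Data.Bool using (Bool; true; false; _∧_; _∨_; not; if_then_else_)
open import Data.Nat using (ℕ; zero; suc; _+_; _*_; _<ᵇ_; _≡ᵇ_; ∣_-_∣)
open import Data.Nat.Divisibility using (_∣?_)
open import Data.Product using (_×_; proj₁; proj₂)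
open import Data.List using (_++_; List; []; _∷_; length; map; concatMap; filter; upTo; zip)
open import Data.Bool.ListAction using (and; or)
open import Relation.Nullary.Decidable using (⌊_⌋)
open import Data.Bool using (T)
open import Data.Bool.Properties using (T?)

-- One-line notation: a permutation of [n] = {1,…,n} is the list
-- [π(1), …, π(n)] of its values.

range1 : ℕ → List ℕ
range1 n = map suc (upTo n)

listsOver : List ℕ → ℕ → List (List ℕ)
listsOver xs zero    = [] ∷ []
listsOver xs (suc r) = concatMap (λ x → map (x ∷_) (listsOver xs r)) xs

elemᵇ : ℕ → List ℕ → Bool
elemᵇ x []       = false
elemᵇ x (y ∷ ys) = (x ≡ᵇ y) ∨ elemᵇ x ys

isPermᵇ : ℕ → List ℕ → Bool
isPermᵇ n xs = (length xs ≡ᵇ n) ∧ and (map (λ v → elemᵇ v xs) (range1 n))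

perms : ℕ → List (List ℕ)
perms n = filter (λ xs → T? (isPermᵇ n xs)) (listsOver (range1 n) n)

congModᵇ : ℕ → ℕ → ℕ → Bool
congModᵇ k a b = ⌊ k ∣? ∣ a - b ∣ ⌋

-- π is mod-k-alternating: π(i) ≡ i (mod k) for every position i ∈ [n]
modAltᵇ : ℕ → List ℕ → Bool
modAltᵇ k xs = and (map (λ p → congModᵇ k (proj₁ p) (proj₂ p)) (zip (range1 (length xs)) xs))

subseqs : ℕ → List ℕ → List (List ℕ)
subseqs zero    xs       = [] ∷ []
subseqs (suc r) []       = []
subseqs (suc r) (x ∷ xs) = map (x ∷_) (subseqs r xs) ++ subseqs (suc r) xs

_==ᵇ_ : Bool → Bool → Bool
true  ==ᵇ b = b
false ==ᵇ b = not b

orderIsoᵇ : List ℕ → List ℕ → Bool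
orderIsoᵇ []       []       = true
orderIsoᵇ []       (_ ∷ _)  = false
orderIsoᵇ (_ ∷ _)  []       = false
orderIsoᵇ (x ∷ xs) (s ∷ ss) =
  (length xs ≡ᵇ length ss)
  ∧ and (map (λ p → ((x <ᵇ proj₁ p) ==ᵇ (s <ᵇ proj₂ p)) ∧ ((proj₁ p <ᵇ x) ==ᵇ (proj₂ p <ᵇ s))) (zip xs ss))
  ∧ orderIsoᵇ xs ss

containsᵇ : List ℕ → List ℕ → Bool
containsᵇ π σ = or (map (λ ys → orderIsoᵇ ys σ) (subseqs (length σ) π))

avoidsᵇ : List ℕ → List ℕ → Bool
avoidsᵇ π σ = not (containsᵇ π σ)

mp : List ℕ → List ℕ → ℕ → ℕ → ℕ
mp σ τ n k = length (filter (λ π → T? (modAltᵇ k π ∧ avoidsᵇ π σ ∧ avoidsᵇ π τ)) (perms n))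

{-# OPTIONS --safe #-}
module Submission where

-- Let π avoid 321 and 132 and let v be its first entry. No low–high–low triple
-- (relative to v) follows v: it would be a 132, or a 321 together with v. So the
-- rest of π is H ++ M ++ N with M below v and H, N above it; M has no descent (a 321
-- with v) and H ++ N has none (a 132 with v), whence π = [c+1 … c+e] [1 … c] [c+e+1 … n].
-- If c, e > 0 this block swap is mod-k-alternating iff k divides c and e; for
-- n = km + l with l < k these are c = ik, e = jk with i, j ≥ 1 and i + j ≤ m,
-- i.e. C(m, 2) of them, plus the identity.

open import Defs
open import Data.Bool using (Bool; true; false; T; _∧_; not)
open import Data.Bool.ListAction using (and)
open import Data.Bool.Properties using (T?; T-∧; T-∨; ∧-comm)
open import Data.Empty using (⊥; ⊥-elim)
open import Data.List using (List; []; _∷_; _++_; length; map; zip; filter; deduplicate; cartesianProductWith; concatMap; applyUpTo)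
open import Data.List.Properties using (∷-injective; ∷-injectiveˡ; ++-assoc; ++-identityʳ; length-++; length-map; length-filter; filter-notAll; length-deduplicate)
open import Data.List.Membership.Propositional using (_∈_; find; lose)
open import Data.List.Membership.Propositional.Properties
open import Data.List.Membership.Propositional.Properties.WithK using (unique∧set⇒bag)
open import Data.List.Relation.Binary.BagAndSetEquality using (∼bag⇒↭)
open import Data.List.Relation.Binary.Permutation.Propositional using (_↭_; ↭-refl; ↭-sym; ↭-trans; ↭-reflexive; ↭⇒↭ₛ)
open import Data.List.Relation.Binary.Permutation.Propositional.Properties using (↭-length; ∈-resp-↭; shifts)
import Data.List.Relation.Binary.Permutation.Setoid.Properties as SetoidPerm
open import Data.List.Relation.Binary.Sublist.Propositional as Sublist using (_⊆_; []; _∷_; _∷ʳ_; from∈; ⊆-refl; ⊆-trans)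
import Data.List.Relation.Binary.Sublist.Propositional.Properties as Sublist
open import Data.List.Relation.Unary.All as All using (All; []; _∷_)
import Data.List.Relation.Unary.All.Properties as AllP
open import Data.List.Relation.Unary.AllPairs as AllPairs using (AllPairs; []; _∷_)
import Data.List.Relation.Unary.AllPairs.Properties as AllPairsP
open import Data.List.Relation.Unary.Any as Any using (here; there)
import Data.List.Relation.Unary.Any.Properties as AnyP
open import Data.List.Relation.Unary.Unique.Propositional using (Unique)
import Data.List.Relation.Unary.Unique.Propositional.Properties as Unique
open import Data.Nat using (ℕ; zero; suc; _+_; _*_; _∸_; _≤_; _<_; _<ᵇ_; _≟_; s≤s; z≤n; z<s; s≤s⁻¹; ∣_-_∣)
open import Data.Nat.Combinatorics using (_C_; nC1≡n; nCk+nC[k+1]≡[n+1]C[k+1])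
open import Data.Nat.Divisibility using (_∣_; divides; n∣m*n; _∣0)
open import Data.Nat.Properties
import Data.List.Relation.Unary.Unique.DecPropositional.Properties _≟_ as DecUnique
open import Data.Product using (∃-syntax; _×_; _,_; _,′_; proj₁; proj₂)
import Data.Product as Product
open import Data.Sum using (_⊎_; inj₁; inj₂; [_,_]′)
open import Data.Unit using (⊤; tt)
open import Function using (id; _∘_; case_of_)
open import Function.Bundles using (_⇔_; mk⇔; Equivalence)
open import Function.Construct.Composition using (_⇔-∘_)
open import Function.Construct.Symmetry using (⇔-sym)
open import Relation.Binary.Definitions using (tri<; tri≈; tri>)
import Relation.Binary.PropositionalEquality as ≡
open import Relation.Binary.PropositionalEquality using (_≡_; _≢_; refl; sym; trans; cong; cong₂; subst; module ≡-Reasoning)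
open import Relation.Nullary using (¬_; contradiction; yes; no)
open import Relation.Nullary.Decidable using (toWitness; fromWitness)
open import Relation.Nullary.Reflects using (ofʸ; ofⁿ)

open Equivalence using (to; from)

private
  variable
    A : Set
    a b c r x y z : ℕ
    xs ys : List A

All-resp-⊆ : ∀ {P : A → Set} → xs ⊆ ys → All P ys → All P xs
All-resp-⊆ τ pys = All.tabulate (λ x∈ → All.lookup pys (Sublist.lookup τ x∈))

AllPairs-resp-⊆ : ∀ {R : A → A → Set} → xs ⊆ ys → AllPairs R ys → AllPairs R xs
AllPairs-resp-⊆ []         []         = []
AllPairs-resp-⊆ (_ ∷ʳ τ)   (_ ∷ rys)  = AllPairs-resp-⊆ τ rys
AllPairs-resp-⊆ (refl ∷ τ) (rx ∷ rys) = All-resp-⊆ τ rx ∷ AllPairs-resp-⊆ τ rys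

pairs⇒AllPairs : ∀ {R : A → A → Set} (ys : List A) → (∀ {a b} → (a ∷ b ∷ []) ⊆ ys → R a b) → AllPairs R ys
pairs⇒AllPairs []       _ = []
pairs⇒AllPairs (y ∷ ys) r =
  All.tabulate (λ b∈ → r (refl ∷ from∈ b∈)) ∷ pairs⇒AllPairs ys (λ τ → r (y ∷ʳ τ))

AllPairs-increasing⁺ : ∀ {R : ℕ → ℕ → Set} → AllPairs _<_ xs →
  (∀ {x y} → x ∈ xs → y ∈ xs → x < y → R x y) → AllPairs R xs
AllPairs-increasing⁺ {xs} xs↑ r = pairs⇒AllPairs xs λ τ →
  r (Sublist.to∈ τ) (Sublist.to∈ (Sublist.∷ˡ⁻ τ)) (All.head (AllPairs.head (AllPairs-resp-⊆ τ xs↑)))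

All²⁺ : ∀ {R : A → A → Set} → (∀ {x y} → x ∈ xs → y ∈ ys → R x y) → All (λ x → All (R x) ys) xs
All²⁺ r = All.tabulate λ x∈ → All.tabulate (r x∈)

Unique∧noDescent⇒increasing : Unique ys → (∀ {a b} → (a ∷ b ∷ []) ⊆ ys → ¬ b < a) → AllPairs _<_ ys
Unique∧noDescent⇒increasing {ys} ys! noDescent = pairs⇒AllPairs ys ordered
  where
  ordered : ∀ {a b} → (a ∷ b ∷ []) ⊆ ys → a < b
  ordered {a} {b} τ with <-cmp a b | AllPairs-resp-⊆ τ ys!
  ... | tri< a<b _ _ | _                = a<b
  ... | tri≈ _ a≡b _ | (a≢b ∷ []) ∷ _   = contradiction a≡b a≢b
  ... | tri> _ _ b<a | _                = contradiction b<a (noDescent τ)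

increasing-∼set⇒≡ : AllPairs _<_ xs → AllPairs _<_ ys → (∀ {z} → z ∈ xs ⇔ z ∈ ys) → xs ≡ ys
increasing-∼set⇒≡ {[]}     {[]}     _ _ _ = refl
increasing-∼set⇒≡ {[]}     {y ∷ ys} _ _ xs∼ys with () ← from xs∼ys (here refl)
increasing-∼set⇒≡ {x ∷ xs} {[]}     _ _ xs∼ys with () ← to xs∼ys (here refl)
increasing-∼set⇒≡ {x ∷ xs} {y ∷ ys} (x< ∷ xs↑) (y< ∷ ys↑) xs∼ys =
  cong₂ _∷_ x≡y (increasing-∼set⇒≡ xs↑ ys↑ (mk⇔ (tail x< y< x≡y xs∼ys) (tail y< x< (sym x≡y) (⇔-sym xs∼ys))))
  where
  x≡y : x ≡ y
  x≡y with to xs∼ys (here refl) | from xs∼ys (here refl)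
  ... | here x≡y  | _         = x≡y
  ... | there x∈  | here y≡x  = sym y≡x
  ... | there x∈  | there y∈  = contradiction (All.lookup y< x∈) (<-asym (All.lookup x< y∈))
  tail : ∀ {a b as bs} → All (a <_) as → All (b <_) bs → a ≡ b →
         (∀ {z} → z ∈ a ∷ as ⇔ z ∈ b ∷ bs) → ∀ {z} → z ∈ as → z ∈ bs
  tail a< b< refl as∼bs z∈ with to as∼bs (there z∈)
  ... | here refl = contradiction (All.lookup a< z∈) (<-irrefl refl)
  ... | there z∈′ = z∈′

length≤deduplicate⇒Unique : ∀ xs → length xs ≤ length (deduplicate _≟_ xs) → Unique xs
length≤deduplicate⇒Unique []       _        = []
length≤deduplicate⇒Unique (x ∷ xs) (s≤s le) =
  All.tabulate x≢ ∷ length≤deduplicate⇒Unique xs (≤-trans le (length-filter _ (deduplicate _≟_ xs)))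
  where
  x≢ : ∀ {y} → y ∈ xs → x ≢ y
  x≢ y∈ refl = <⇒≱ (filter-notAll _ _ (Any.map (λ x≡ x≢ → x≢ x≡) (∈-deduplicate⁺ _≟_ y∈)))
                   (≤-trans (length-deduplicate _≟_ xs) le)

Unique∧∼set⇒↭ : Unique xs → Unique ys → (∀ {z} → z ∈ xs ⇔ z ∈ ys) → xs ↭ ys
Unique∧∼set⇒↭ xs! ys! xs∼ys = ∼bag⇒↭ (unique∧set⇒bag xs! ys! xs∼ys)

↭⇒∼set : xs ↭ ys → ∀ {z} → z ∈ xs ⇔ z ∈ ys
↭⇒∼set p = mk⇔ (∈-resp-↭ p) (∈-resp-↭ (↭-sym p))

Unique-resp-↭ : xs ↭ ys → Unique xs → Unique ys
Unique-resp-↭ p = SetoidPerm.Unique-resp-↭ (≡.setoid _) (↭⇒↭ₛ p)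

interval : ℕ → ℕ → List ℕ
interval lo zero    = []
interval lo (suc n) = lo ∷ interval (suc lo) n

range1≡interval : ∀ n → range1 n ≡ interval 1 n
range1≡interval n = go id 0 n (λ _ → refl)
  where
  go : ∀ f lo n → (∀ i → f i ≡ lo + i) → map suc (applyUpTo f n) ≡ interval (suc lo) n
  go f lo zero    f≗ = refl
  go f lo (suc n) f≗ = cong₂ _∷_ (cong suc (trans (f≗ 0) (+-identityʳ lo)))
                        (go (λ i → f (suc i)) (suc lo) n (λ i → trans (f≗ (suc i)) (+-suc lo i)))

∈-interval⇔ : ∀ {x lo n} → x ∈ interval lo n ⇔ (lo ≤ x × x < lo + n)
∈-interval⇔ = mk⇔ ∈⁻ ∈⁺
  where
  ∈⁻ : ∀ {x lo n} → x ∈ interval lo n → lo ≤ x × x < lo + n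
  ∈⁻ {lo = lo} {suc n} (here refl) = ≤-refl , m<m+n lo z<s
  ∈⁻ {x} {lo} {suc n} (there x∈) =
    let lo<x , x<end = ∈⁻ x∈ in <⇒≤ lo<x , subst (x <_) (sym (+-suc lo n)) x<end
  ∈⁺ : ∀ {x lo n} → lo ≤ x × x < lo + n → x ∈ interval lo n
  ∈⁺ {x} {lo} {zero}  (lo≤x , x<lo+0) = contradiction (subst (x <_) (+-identityʳ lo) x<lo+0) (≤⇒≯ lo≤x)
  ∈⁺ {x} {lo} {suc n} (lo≤x , x<end) with lo ≟ x
  ... | yes refl = here refl
  ... | no lo≢x  = there (∈⁺ (≤∧≢⇒< lo≤x lo≢x , subst (x <_) (+-suc lo n) x<end))

interval-increasing : ∀ lo n → AllPairs _<_ (interval lo n)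
interval-increasing lo zero    = []
interval-increasing lo (suc n) =
  All.tabulate (λ y∈ → proj₁ (to ∈-interval⇔ y∈)) ∷ interval-increasing (suc lo) n

interval-unique : ∀ lo n → Unique (interval lo n)
interval-unique lo n = AllPairs.map <⇒≢ (interval-increasing lo n)

length-interval : ∀ lo n → length (interval lo n) ≡ n
length-interval lo zero    = refl
length-interval lo (suc n) = cong suc (length-interval (suc lo) n)

interval-++ : ∀ lo p q → interval lo p ++ interval (lo + p) q ≡ interval lo (p + q)
interval-++ lo zero    q = cong (λ i → interval i q) (+-identityʳ lo)
interval-++ lo (suc p) q =
  cong (lo ∷_) (trans (cong (λ i → interval (suc lo) p ++ interval i q) (+-suc lo p)) (interval-++ (suc lo) p q))

interval-++⁻ : ∀ xs ys lo n → xs ++ ys ≡ interval lo n →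
  ∃[ p ] ∃[ q ] (xs ≡ interval lo p × ys ≡ interval (lo + p) q × p + q ≡ n)
interval-++⁻ []       ys lo n       eq = 0 , n , refl , trans eq (cong (λ i → interval i n) (sym (+-identityʳ lo))) , refl
interval-++⁻ (x ∷ xs) ys lo (suc n) eq with refl , eq′ ← ∷-injective eq
  with p , q , xs≡ , ys≡ , p+q≡n ← interval-++⁻ xs ys (suc lo) n eq′ =
  suc p , q , cong (lo ∷_) xs≡ , trans ys≡ (cong (λ i → interval i q) (sym (+-suc lo p))) , cong suc p+q≡n

T-not⇔¬T : ∀ {p} → T (not p) ⇔ (¬ T p)
T-not⇔¬T {true}  = mk⇔ (λ ()) (λ ¬t → ¬t tt)
T-not⇔¬T {false} = mk⇔ (λ _ ()) (λ _ → tt)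

elemᵇ⇔∈ : ∀ {x} xs → T (elemᵇ x xs) ⇔ x ∈ xs
elemᵇ⇔∈ []       = mk⇔ (λ ()) (λ ())
elemᵇ⇔∈ {x} (y ∷ ys) = mk⇔
  (λ t → [ here ∘ ≡ᵇ⇒≡ x y , there ∘ to (elemᵇ⇔∈ ys) ]′ (to T-∨ t))
  (λ { (here refl) → from T-∨ (inj₁ (≡⇒≡ᵇ x x refl)) ; (there x∈) → from T-∨ (inj₂ (from (elemᵇ⇔∈ ys) x∈)) })

isPermᵇ⇔ : ∀ {n π} → T (isPermᵇ n π) ⇔ (length π ≡ n × All (_∈ π) (interval 1 n))
isPermᵇ⇔ {n} {π} = mk⇔
  (λ t → let len , elems = to T-∧ t in
     ≡ᵇ⇒≡ _ _ len , subst (All (_∈ π)) (range1≡interval n) (All.map (to (elemᵇ⇔∈ π)) (AllP.all⁺ _ _ elems)))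
  (λ (len , elems) → from T-∧ (≡⇒≡ᵇ _ _ len ,
     AllP.all⁻ _ (All.map (from (elemᵇ⇔∈ π)) (subst (All (_∈ π)) (sym (range1≡interval n)) elems))))

listsOver≡cartesianProduct : ∀ xs r →
  listsOver xs (suc r) ≡ cartesianProductWith _∷_ xs (listsOver xs r)
listsOver≡cartesianProduct xs r = go xs
  where
  go : ∀ ys → concatMap (λ y → map (y ∷_) (listsOver xs r)) ys ≡ cartesianProductWith _∷_ ys (listsOver xs r)
  go []       = refl
  go (y ∷ ys) = cong (map (y ∷_) (listsOver xs r) ++_) (go ys)

listsOver-unique : Unique xs → ∀ r → Unique (listsOver xs r)
listsOver-unique xs! zero    = [] ∷ []
listsOver-unique {xs} xs! (suc r) rewrite listsOver≡cartesianProduct xs r =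
  Unique.cartesianProductWith⁺ _∷_ ∷-injective xs! (listsOver-unique xs! r)

∈-listsOver⇔ : ys ∈ listsOver xs r ⇔ (length ys ≡ r × All (_∈ xs) ys)
∈-listsOver⇔ = mk⇔ ∈⁻ (λ (len , ys⊆) → ∈⁺ len ys⊆)
  where
  ∈⁻ : ∀ {ys xs r} → ys ∈ listsOver xs r → length ys ≡ r × All (_∈ xs) ys
  ∈⁻ {r = zero} (here refl) = refl , []
  ∈⁻ {xs = xs} {suc r} ys∈ rewrite listsOver≡cartesianProduct xs r
    with y , zs , y∈ , zs∈ , refl ← ∈-cartesianProductWith⁻ _∷_ xs (listsOver xs r) ys∈ =
    let len , zs⊆ = ∈⁻ zs∈ in cong suc len , y∈ ∷ zs⊆
  ∈⁺ : ∀ {ys xs r} → length ys ≡ r → All (_∈ xs) ys → ys ∈ listsOver xs r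
  ∈⁺ {[]}     refl []          = here refl
  ∈⁺ {y ∷ ys} {xs} refl (y∈ ∷ ys⊆) rewrite listsOver≡cartesianProduct xs (length ys) =
    ∈-cartesianProductWith⁺ _∷_ y∈ (∈⁺ refl ys⊆)

∈-perms⇔ : ∀ {π n} → π ∈ perms n ⇔ (π ↭ interval 1 n)
∈-perms⇔ {π} {n} = mk⇔ permutation listed
  where
  onRange : ∀ {x} → x ∈ range1 n ⇔ x ∈ interval 1 n
  onRange = mk⇔ (subst (_ ∈_) (range1≡interval n)) (subst (_ ∈_) (sym (range1≡interval n)))
  permutation : π ∈ perms n → π ↭ interval 1 n
  permutation π∈ = Unique∧∼set⇒↭ π! (interval-unique 1 n) π∼interval
    where
    len,inRange = to ∈-listsOver⇔ (proj₁ (∈-filter⁻ _ π∈))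
    len,covers  = to isPermᵇ⇔ (proj₂ (∈-filter⁻ _ {xs = listsOver (range1 n) n} π∈))
    π∼interval : ∀ {x} → x ∈ π ⇔ x ∈ interval 1 n
    π∼interval = mk⇔ (to onRange ∘ All.lookup (proj₂ len,inRange)) (All.lookup (proj₂ len,covers))
    dedup∼interval : ∀ {x} → x ∈ deduplicate _≟_ π ⇔ x ∈ interval 1 n
    dedup∼interval = mk⇔ (to π∼interval ∘ ∈-deduplicate⁻ _≟_ π) (∈-deduplicate⁺ _≟_ ∘ from π∼interval)
    π! : Unique π
    π! = length≤deduplicate⇒Unique π (≤-reflexive (begin
      length π                       ≡⟨ proj₁ len,inRange ⟩
      n                              ≡⟨ length-interval 1 n ⟨
      length (interval 1 n)          ≡⟨ ↭-length (Unique∧∼set⇒↭ (DecUnique.deduplicate-! π) (interval-unique 1 n) dedup∼interval) ⟨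
      length (deduplicate _≟_ π)     ∎))
      where open ≡-Reasoning
  listed : π ↭ interval 1 n → π ∈ perms n
  listed π↭ = ∈-filter⁺ _
    (from ∈-listsOver⇔ (len , All.tabulate (from onRange ∘ to (↭⇒∼set π↭))))
    (from isPermᵇ⇔ (len , All.tabulate (from (↭⇒∼set π↭))))
    where
    len : length π ≡ n
    len = trans (↭-length π↭) (length-interval 1 n)

perms-unique : ∀ n → Unique (perms n)
perms-unique n = Unique.filter⁺ _ (listsOver-unique (subst Unique (sym (range1≡interval n)) (interval-unique 1 n)) n)

∈-subseqs⁻ : ∀ r xs → ys ∈ subseqs r xs → ys ⊆ xs
∈-subseqs⁻ zero    xs       (here refl) = Sublist.minimum xs
∈-subseqs⁻ (suc r) (x ∷ xs) ys∈ with ∈-++⁻ (map (x ∷_) (subseqs r xs)) ys∈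
... | inj₂ ys∈′ = x ∷ʳ ∈-subseqs⁻ (suc r) xs ys∈′
... | inj₁ ys∈′ with ∈-map⁻ (x ∷_) ys∈′
...   | _ , zs∈ , refl = refl ∷ ∈-subseqs⁻ r xs zs∈

∈-subseqs⁺ : ys ⊆ xs → ys ∈ subseqs (length ys) xs
∈-subseqs⁺ []                 = here refl
∈-subseqs⁺ {[]}     (x ∷ʳ τ)  = here refl
∈-subseqs⁺ {_ ∷ ys} (x ∷ʳ τ)  = ∈-++⁺ʳ (map (x ∷_) (subseqs (length ys) _)) (∈-subseqs⁺ τ)
∈-subseqs⁺ (refl ∷ τ)         = ∈-++⁺ˡ (∈-map⁺ _ (∈-subseqs⁺ τ))

orderIsoᵇ⇒length≡ : ∀ xs σ → T (orderIsoᵇ xs σ) → length xs ≡ length σ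
orderIsoᵇ⇒length≡ []       []       _ = refl
orderIsoᵇ⇒length≡ (_ ∷ xs) (_ ∷ σ)  t = cong suc (≡ᵇ⇒≡ _ _ (proj₁ (to T-∧ t)))

containsᵇ⇔ : ∀ π σ → T (containsᵇ π σ) ⇔ (∃[ ys ] (ys ⊆ π × T (orderIsoᵇ ys σ)))
containsᵇ⇔ π σ = mk⇔ found (λ (ys , τ , iso) → AnyP.any⁺ _ (lose (sameLength ys τ iso) iso))
  where
  found : T (containsᵇ π σ) → ∃[ ys ] (ys ⊆ π × T (orderIsoᵇ ys σ))
  found t with find (AnyP.any⁻ _ _ t)
  ... | ys , ys∈ , iso = ys , ∈-subseqs⁻ (length σ) π ys∈ , iso
  sameLength : ∀ ys → ys ⊆ π → T (orderIsoᵇ ys σ) → ys ∈ subseqs (length σ) π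
  sameLength ys τ iso = subst (λ r → ys ∈ subseqs r π) (orderIsoᵇ⇒length≡ ys σ iso) (∈-subseqs⁺ τ)

sameOrderᵇ : ℕ → ℕ → ℕ → ℕ → Bool
sameOrderᵇ a b x y = ((a <ᵇ b) ==ᵇ (x <ᵇ y)) ∧ ((b <ᵇ a) ==ᵇ (y <ᵇ x))

sameOrderᵇ-desc : y < x → T (sameOrderᵇ a b x y) ⇔ b < a
sameOrderᵇ-desc {y} {x} {a} {b} y<x
  with x <ᵇ y | <ᵇ-reflects-< x y | y <ᵇ x | <ᵇ-reflects-< y x
... | true  | ofʸ x<y | _    | _        = contradiction x<y (<-asym y<x)
... | _     | _       | false | ofⁿ y≮x = contradiction y<x y≮x
... | false | _       | true  | _
  with a <ᵇ b | <ᵇ-reflects-< a b | b <ᵇ a | <ᵇ-reflects-< b a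
...   | true  | ofʸ a<b | _     | _        = mk⇔ (λ ()) (<-asym a<b)
...   | false | _       | true  | ofʸ b<a  = mk⇔ (λ _ → b<a) (λ _ → tt)
...   | false | _       | false | ofⁿ b≮a  = mk⇔ (λ ()) b≮a

sameOrderᵇ-asc : x < y → T (sameOrderᵇ a b x y) ⇔ a < b
sameOrderᵇ-asc {x} {y} {a} {b} x<y
  rewrite ∧-comm ((a <ᵇ b) ==ᵇ (x <ᵇ y)) ((b <ᵇ a) ==ᵇ (y <ᵇ x)) = sameOrderᵇ-desc x<y

orderIsoᵇ-triple⇔ : T (orderIsoᵇ (a ∷ b ∷ c ∷ []) (x ∷ y ∷ z ∷ [])) ⇔
  (T (sameOrderᵇ a b x y) × T (sameOrderᵇ a c x z) × T (sameOrderᵇ b c y z))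
orderIsoᵇ-triple⇔ {a} {b} {c} {x} {y} {z}
  -- on triples orderIsoᵇ reduces to a conjunction of exactly these three tests
  with sameOrderᵇ a b x y | sameOrderᵇ a c x z | sameOrderᵇ b c y z
... | true  | true  | true  = mk⇔ (λ _ → tt , tt , tt) (λ _ → tt)
... | false | _     | _     = mk⇔ (λ ()) (λ ())
... | true  | false | _     = mk⇔ (λ ()) (λ ())
... | true  | true  | false = mk⇔ (λ ()) (λ ())

Occurs : (ℕ → ℕ → ℕ → Set) → List ℕ → Set
Occurs R π = ∃[ a ] ∃[ b ] ∃[ c ] ((a ∷ b ∷ c ∷ []) ⊆ π × R a b c)

avoidsᵇ⇔¬Occurs : ∀ {R : ℕ → ℕ → ℕ → Set} π x y z →
  (∀ {a b c} → T (orderIsoᵇ (a ∷ b ∷ c ∷ []) (x ∷ y ∷ z ∷ [])) ⇔ R a b c) →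
  T (avoidsᵇ π (x ∷ y ∷ z ∷ [])) ⇔ (¬ Occurs R π)
avoidsᵇ⇔¬Occurs {R} π x y z iso⇔R = mk⇔
  (λ avoids (a , b , c , τ , r) → to T-not⇔¬T avoids (from contains (_ , τ , from iso⇔R r)))
  (λ ¬occ → from T-not⇔¬T (λ t → ¬occ (occurrence (to contains t))))
  where
  contains = containsᵇ⇔ π (x ∷ y ∷ z ∷ [])
  occurrence : ∃[ ys ] (ys ⊆ π × T (orderIsoᵇ ys (x ∷ y ∷ z ∷ []))) → Occurs R π
  occurrence (a ∷ b ∷ c ∷ [] , τ , iso) = a , b , c , τ , to iso⇔R iso
  occurrence ([]                , _ , ())
  occurrence (_ ∷ []            , _ , ())
  occurrence (_ ∷ _ ∷ []        , _ , ())
  occurrence (_ ∷ _ ∷ _ ∷ _ ∷ _ , _ , ())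

Pattern321 Pattern132 : ℕ → ℕ → ℕ → Set
Pattern321 a b c = c < b × b < a
Pattern132 a b c = a < c × c < b

orderIso321⇔ : T (orderIsoᵇ (a ∷ b ∷ c ∷ []) (3 ∷ 2 ∷ 1 ∷ [])) ⇔ Pattern321 a b c
orderIso321⇔ {a} {b} {c} = mk⇔
  (λ iso → let ab , _ , bc = to triple iso in to bc⇔ bc , to ab⇔ ab)
  (λ (c<b , b<a) → from triple (from ab⇔ b<a , from ac⇔ (<-trans c<b b<a) , from bc⇔ c<b))
  where
  triple = orderIsoᵇ-triple⇔ {a} {b} {c} {3} {2} {1}
  ab⇔ = sameOrderᵇ-desc {y = 2} {x = 3} {a = a} {b = b} (s≤s (s≤s (s≤s z≤n)))
  ac⇔ = sameOrderᵇ-desc {y = 1} {x = 3} {a = a} {b = c} (s≤s (s≤s z≤n))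
  bc⇔ = sameOrderᵇ-desc {y = 1} {x = 2} {a = b} {b = c} (s≤s (s≤s z≤n))

orderIso132⇔ : T (orderIsoᵇ (a ∷ b ∷ c ∷ []) (1 ∷ 3 ∷ 2 ∷ [])) ⇔ Pattern132 a b c
orderIso132⇔ {a} {b} {c} = mk⇔
  (λ iso → let _ , ac , bc = to triple iso in to ac⇔ ac , to bc⇔ bc)
  (λ (a<c , c<b) → from triple (from ab⇔ (<-trans a<c c<b) , from ac⇔ a<c , from bc⇔ c<b))
  where
  triple = orderIsoᵇ-triple⇔ {a} {b} {c} {1} {3} {2}
  ab⇔ = sameOrderᵇ-asc {x = 1} {y = 3} {a = a} {b = b} (s≤s (s≤s z≤n))
  ac⇔ = sameOrderᵇ-asc {x = 1} {y = 2} {a = a} {b = c} (s≤s (s≤s z≤n))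
  bc⇔ = sameOrderᵇ-desc {y = 2} {x = 3} {a = b} {b = c} (s≤s (s≤s (s≤s z≤n)))

AlternatingFrom : ℕ → ℕ → List ℕ → Set
AlternatingFrom k i []       = ⊤
AlternatingFrom k i (x ∷ xs) = k ∣ ∣ i - x ∣ × AlternatingFrom k (suc i) xs

modAltᵇ⇔ : ∀ k π → T (modAltᵇ k π) ⇔ AlternatingFrom k 1 π
modAltᵇ⇔ k π rewrite range1≡interval (length π) = go 1 π
  where
  go : ∀ i xs → T (and (map (λ p → congModᵇ k (proj₁ p) (proj₂ p)) (zip (interval i (length xs)) xs)))
                ⇔ AlternatingFrom k i xs
  go i []       = mk⇔ (λ _ → tt) (λ _ → tt)
  go i (x ∷ xs) = mk⇔
    (λ t → let d , rest = to T-∧ t in toWitness d , to (go (suc i) xs) rest)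
    (λ (d , rest) → from T-∧ (fromWitness d , from (go (suc i) xs) rest))

AlternatingFrom-++⇔ : ∀ k i xs → AlternatingFrom k i (xs ++ ys) ⇔ (AlternatingFrom k i xs × AlternatingFrom k (i + length xs) ys)
AlternatingFrom-++⇔ {ys} k i [] = mk⇔ (λ a → tt , subst (λ j → AlternatingFrom k j ys) (sym (+-identityʳ i)) a)
                                      (λ (_ , a) → subst (λ j → AlternatingFrom k j ys) (+-identityʳ i) a)
AlternatingFrom-++⇔ {ys} k i (x ∷ xs) = mk⇔
  (λ (d , a) → let a₁ , a₂ = to (AlternatingFrom-++⇔ k (suc i) xs) a
               in (d , a₁) , subst (λ j → AlternatingFrom k j ys) (sym (+-suc i (length xs))) a₂)
  (λ ((d , a₁) , a₂) → d , from (AlternatingFrom-++⇔ k (suc i) xs)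
                             (a₁ , subst (λ j → AlternatingFrom k j ys) (+-suc i (length xs)) a₂))

AlternatingFrom-interval : ∀ k i j n → k ∣ ∣ i - j ∣ → AlternatingFrom k i (interval j n)
AlternatingFrom-interval k i j zero    _ = tt
AlternatingFrom-interval k i j (suc n) d = d , AlternatingFrom-interval k (suc i) (suc j) n d

interval-alternating : ∀ k n → AlternatingFrom k 1 (interval 1 n)
interval-alternating k n = AlternatingFrom-interval k 1 1 n (k ∣0)

≢⇒≶ : ∀ {v y} → v ≢ y → y < v ⊎ v < y
≢⇒≶ {v} {y} v≢y with <-cmp y v
... | tri< y<v _ _ = inj₁ y<v
... | tri≈ _ y≡v _ = contradiction (sym y≡v) v≢y
... | tri> _ _ v<y = inj₂ v<y

split-high-low-high : ∀ v t → All (λ y → y < v ⊎ v < y) t →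
  (∀ {a b c} → (a ∷ b ∷ c ∷ []) ⊆ t → a < v → v < b → c < v → ⊥) →
  ∃[ H ] ∃[ M ] ∃[ N ] (t ≡ H ++ M ++ N × All (v <_) H × All (_< v) M × All (v <_) N)
split-high-low-high v []      _            _     = [] , [] , [] , refl , [] , [] , []
split-high-low-high v (x ∷ t) (x≶v ∷ t≶v) noLHL
  with split-high-low-high v t t≶v (λ τ → noLHL (x ∷ʳ τ)) | x≶v
... | H , M , N , refl , H> , M< , N> | inj₂ v<x = x ∷ H , M , N , refl , v<x ∷ H> , M< , N>
... | [] , M , N , refl , _ , M< , N> | inj₁ x<v = [] , x ∷ M , N , refl , [] , x<v ∷ M< , N>
... | h ∷ H , [] , N , refl , H> , _ , N> | inj₁ x<v = [] , x ∷ [] , h ∷ H ++ N , refl , [] , x<v ∷ [] , AllP.++⁺ H> N>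
... | h ∷ H , l ∷ M , N , refl , v<h ∷ _ , l<v ∷ _ , _ | inj₁ x<v =
  contradiction (refl ∷ refl ∷ Sublist.++⁺ˡ H (from∈ (here refl))) (λ τ → noLHL τ x<v v<h l<v)

noLowHighLow : ∀ {v t a b d} → Unique (v ∷ t) → ¬ Occurs Pattern321 (v ∷ t) → ¬ Occurs Pattern132 (v ∷ t) →
  (a ∷ b ∷ d ∷ []) ⊆ t → a < v → v < b → d < v → ⊥
noLowHighLow {v} {t} {a} {b} {d} (_ ∷ t!) no321 no132 τ a<v v<b d<v with <-cmp a d | AllPairs-resp-⊆ τ t!
... | tri< a<d _ _ | _                    = no132 (a , b , d , v ∷ʳ τ , a<d , <-trans d<v v<b)
... | tri≈ _ a≡d _ | (_ ∷ a≢d ∷ []) ∷ _  = a≢d a≡d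
... | tri> _ _ d<a | _                    = no321 (v , a , d , refl ∷ ⊆-trans (refl ∷ b ∷ʳ ⊆-refl) τ , d<a , a<v)

swapBlocks : ℕ → ℕ → ℕ → List ℕ
swapBlocks c e r = interval (suc c) e ++ interval 1 c ++ interval (suc (c + e)) r

∈-low⇔ : ∀ {v x} H M N → All (v <_) H → All (_< v) M → All (v <_) N →
  x ∈ M ⇔ (x ∈ H ++ M ++ N × x < v)
∈-low⇔ H M N H> M< N> = mk⇔ (λ x∈ → ∈-++⁺ʳ H (∈-++⁺ˡ x∈) , All.lookup M< x∈) λ (x∈ , x<v) →
  case ∈-++⁻ H x∈ of λ where
    (inj₁ x∈H) → contradiction (All.lookup H> x∈H) (<-asym x<v)
    (inj₂ x∈MN) → case ∈-++⁻ M x∈MN of λ where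
      (inj₁ x∈M) → x∈M
      (inj₂ x∈N) → contradiction (All.lookup N> x∈N) (<-asym x<v)

∈-high⇔ : ∀ {v x} H M N → All (v <_) H → All (_< v) M → All (v <_) N →
  x ∈ H ++ N ⇔ (x ∈ H ++ M ++ N × v < x)
∈-high⇔ H M N H> M< N> = mk⇔
  (λ x∈ → case ∈-++⁻ H x∈ of λ where
    (inj₁ x∈H) → ∈-++⁺ˡ x∈H , All.lookup H> x∈H
    (inj₂ x∈N) → ∈-++⁺ʳ H (∈-++⁺ʳ M x∈N) , All.lookup N> x∈N)
  λ (x∈ , v<x) → case ∈-++⁻ H x∈ of λ where
    (inj₁ x∈H) → ∈-++⁺ˡ x∈H
    (inj₂ x∈MN) → case ∈-++⁻ M x∈MN of λ where
      (inj₁ x∈M) → contradiction (All.lookup M< x∈M) (<-asym v<x)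
      (inj₂ x∈N) → ∈-++⁺ʳ H x∈N

∈-tail⇔ : ∀ {v t n x} → v ∷ t ↭ interval 1 n → x ∈ t ⇔ (x ∈ interval 1 n × x ≢ v)
∈-tail⇔ {v} {t} {n} π↭ = mk⇔
  (λ x∈ → ∈-resp-↭ π↭ (there x∈) , λ { refl → All.lookup v∉t x∈ refl })
  λ (x∈ , x≢v) → case ∈-resp-↭ (↭-sym π↭) x∈ of λ where
    (here x≡v) → contradiction x≡v x≢v
    (there x∈t) → x∈t
  where
  v∉t = AllPairs.head (Unique-resp-↭ (↭-sym π↭) (interval-unique 1 n))

swapBlocks-from-highLowHigh : ∀ {n} c H M N → let t = H ++ M ++ N in
  suc c ∷ t ↭ interval 1 n → ¬ Occurs Pattern321 (suc c ∷ t) → ¬ Occurs Pattern132 (suc c ∷ t) →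
  All (suc c <_) H → All (_< suc c) M → All (suc c <_) N →
  ∃[ e ] ∃[ r ] (suc c ∷ t ≡ swapBlocks c e r × c + e + r ≡ n)
swapBlocks-from-highLowHigh {n} c H M N π↭ no321 no132 H> M< N> =
  assemble (interval-++⁻ H N (suc v) K (increasing-∼set⇒≡ HN↑ (interval-increasing (suc v) K) HN∼))
  where
  v = suc c
  K = n ∸ v
  t! = AllPairs.tail (Unique-resp-↭ (↭-sym π↭) (interval-unique 1 n))
  v<1+n : v < suc n
  v<1+n = proj₂ (to ∈-interval⇔ (∈-resp-↭ π↭ (here refl)))
  v+K≡n : v + K ≡ n
  v+K≡n = m+[n∸m]≡n (s≤s⁻¹ v<1+n)
  M↑ : AllPairs _<_ M
  M↑ = Unique∧noDescent⇒increasing (AllPairs-resp-⊆ M⊆t t!) λ τ b<a →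
    no321 (_ , _ , _ , refl ∷ ⊆-trans τ M⊆t , b<a , All.lookup M< (Sublist.to∈ τ))
    where M⊆t = Sublist.++⁺ˡ H (Sublist.++⁺ʳ N ⊆-refl)
  HN↑ : AllPairs _<_ (H ++ N)
  HN↑ = Unique∧noDescent⇒increasing (AllPairs-resp-⊆ HN⊆t t!) λ τ b<a →
    no132 (_ , _ , _ , refl ∷ ⊆-trans τ HN⊆t , All.lookup (AllP.++⁺ H> N>) (Sublist.to∈ (Sublist.∷ˡ⁻ τ)) , b<a)
    where HN⊆t = Sublist.++⁺ {as = H} ⊆-refl (Sublist.++⁺ˡ M ⊆-refl)
  M∼ : ∀ {x} → x ∈ M ⇔ x ∈ interval 1 c
  M∼ = mk⇔
    (λ x∈ → let x∈t , x<v = to (∈-low⇔ H M N H> M< N>) x∈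
            in from ∈-interval⇔ (proj₁ (to ∈-interval⇔ (proj₁ (to (∈-tail⇔ π↭) x∈t))) , x<v))
    (λ x∈ → let 1≤x , x<v = to ∈-interval⇔ x∈
                x∈t = from (∈-tail⇔ π↭) (from ∈-interval⇔ (1≤x , <-trans x<v v<1+n) , <⇒≢ x<v)
            in from (∈-low⇔ H M N H> M< N>) (x∈t , x<v))
  HN∼ : ∀ {x} → x ∈ H ++ N ⇔ x ∈ interval (suc v) K
  HN∼ {x} = mk⇔
    (λ x∈ → let x∈t , v<x = to (∈-high⇔ H M N H> M< N>) x∈
                x<1+n = proj₂ (to ∈-interval⇔ (proj₁ (to (∈-tail⇔ π↭) x∈t)))
            in from ∈-interval⇔ (v<x , subst (x <_) (cong suc (sym v+K≡n)) x<1+n))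
    (λ x∈ → let v<x , x<end = to ∈-interval⇔ x∈
                x∈t = from (∈-tail⇔ π↭) (from ∈-interval⇔ (≤-trans (s≤s z≤n) v<x , subst (x <_) (cong suc v+K≡n) x<end) , >⇒≢ v<x)
            in from (∈-high⇔ H M N H> M< N>) (x∈t , v<x))
  assemble : ∃[ p ] ∃[ q ] (H ≡ interval (suc v) p × N ≡ interval (suc v + p) q × p + q ≡ K) →
             ∃[ e ] ∃[ r ] (suc c ∷ H ++ M ++ N ≡ swapBlocks c e r × c + e + r ≡ n)
  assemble (p , q , H≡ , N≡ , p+q≡K) = suc p , q ,
    cong (v ∷_) (cong₂ _++_ H≡ (cong₂ _++_ M≡ (trans N≡ (cong (λ i → interval (suc i) q) (sym (+-suc c p)))))) ,
    (begin
      c + suc p + q   ≡⟨ cong (_+ q) (+-suc c p) ⟩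
      v + p + q       ≡⟨ +-assoc v p q ⟩
      v + (p + q)     ≡⟨ cong (v +_) p+q≡K ⟩
      v + K           ≡⟨ v+K≡n ⟩
      n               ∎)
    where
    M≡ = increasing-∼set⇒≡ M↑ (interval-increasing 1 c) M∼
    open ≡-Reasoning

avoider⇒swapBlocks : ∀ {π n} → π ↭ interval 1 n → ¬ Occurs Pattern321 π → ¬ Occurs Pattern132 π →
  ∃[ c ] ∃[ e ] ∃[ r ] (π ≡ swapBlocks c e r × c + e + r ≡ n)
avoider⇒swapBlocks {[]} {zero} _ _ _ = 0 , 0 , 0 , refl , refl
avoider⇒swapBlocks {[]} {suc n} π↭ _ _ with () ← ∈-resp-↭ (↭-sym π↭) (here refl)
avoider⇒swapBlocks {zero ∷ t} π↭ _ _ with () ← proj₁ (to ∈-interval⇔ (∈-resp-↭ π↭ (here refl)))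
avoider⇒swapBlocks {suc c ∷ t} {n} π↭ no321 no132
  with H , M , N , refl , H> , M< , N> ←
       split-high-low-high (suc c) t (All.map ≢⇒≶ (AllPairs.head (Unique-resp-↭ (↭-sym π↭) (interval-unique 1 n))))
                     (noLowHighLow (Unique-resp-↭ (↭-sym π↭) (interval-unique 1 n)) no321 no132) =
  c , swapBlocks-from-highLowHigh c H M N π↭ no321 no132 H> M< N>

swapBlocks↭interval : ∀ c e r → swapBlocks c e r ↭ interval 1 (c + e + r)
swapBlocks↭interval c e r = ↭-trans (shifts (interval (suc c) e) (interval 1 c)) (↭-reflexive (begin
  interval 1 c ++ interval (suc c) e ++ interval (suc (c + e)) r   ≡⟨ ++-assoc (interval 1 c) _ _ ⟨
  (interval 1 c ++ interval (suc c) e) ++ interval (suc (c + e)) r ≡⟨ cong (_++ interval (suc (c + e)) r) (interval-++ 1 c e) ⟩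
  interval 1 (c + e) ++ interval (suc (c + e)) r                   ≡⟨ interval-++ 1 (c + e) r ⟩
  interval 1 (c + e + r)                                           ∎))
  where open ≡-Reasoning

swapBlocks-trivial : ∀ c e r → c ≡ 0 ⊎ e ≡ 0 → swapBlocks c e r ≡ interval 1 (c + e + r)
swapBlocks-trivial c e r (inj₁ refl) = interval-++ 1 e r
swapBlocks-trivial c e r (inj₂ refl) = trans (cong (λ i → interval 1 c ++ interval (suc i) r) (+-identityʳ c))
  (trans (interval-++ 1 c r) (cong (λ i → interval 1 (i + r)) (sym (+-identityʳ c))))

BlockOrdered : ℕ → ℕ → ℕ → ℕ → Set
BlockOrdered c d x y = (y < x → y ≤ c × c < x × x ≤ d) × (x ≤ c → c < y → d < y)

blockOrdered⇒¬321 : ∀ {c d π} → AllPairs (BlockOrdered c d) π → ¬ Occurs Pattern321 π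
blockOrdered⇒¬321 π↕ (a , b , _ , τ , d<b , b<a) with AllPairs-resp-⊆ τ π↕
... | (ab ∷ _) ∷ (bd ∷ []) ∷ _ = <⇒≱ (proj₁ (proj₂ (proj₁ bd d<b))) (proj₁ (proj₁ ab b<a))

blockOrdered⇒¬132 : ∀ {c d π} → AllPairs (BlockOrdered c d) π → ¬ Occurs Pattern132 π
blockOrdered⇒¬132 π↕ (a , b , d , τ , a<d , d<b) with AllPairs-resp-⊆ τ π↕
... | (ab ∷ _) ∷ (bd ∷ []) ∷ _ =
  let d≤c , c<b , b≤end = proj₁ bd d<b in <⇒≱ (proj₂ ab (≤-trans (<⇒≤ a<d) d≤c) c<b) b≤end

swapBlocks-blockOrdered : ∀ c e r → AllPairs (BlockOrdered c (c + e)) (swapBlocks c e r)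
swapBlocks-blockOrdered c e r =
  AllPairsP.++⁺
    (AllPairs-increasing⁺ (interval-increasing _ e) λ x∈A _ → ascending λ x≤c _ → ⊥-elim (<⇒≱ (inA x∈A .proj₁) x≤c))
    (AllPairsP.++⁺
      (AllPairs-increasing⁺ (interval-increasing 1 c) λ _ y∈B → ascending λ _ c<y → ⊥-elim (<⇒≱ c<y (inB y∈B)))
      (AllPairs-increasing⁺ (interval-increasing _ r) λ x∈C _ →
        ascending λ x≤c _ → ⊥-elim (<⇒≱ (≤-<-trans (m≤m+n c e) (inC x∈C)) x≤c))
      (All²⁺ λ x∈B y∈C → ascending (λ _ _ → inC y∈C) (≤-<-trans (≤-trans (inB x∈B) (m≤m+n c e)) (inC y∈C))))
    (All²⁺ λ x∈A y∈BC → case ∈-++⁻ (interval 1 c) y∈BC of λ where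
      (inj₁ y∈B) → (λ _ → inB y∈B , inA x∈A) , λ x≤c _ → ⊥-elim (<⇒≱ (inA x∈A .proj₁) x≤c)
      (inj₂ y∈C) → ascending (λ x≤c _ → ⊥-elim (<⇒≱ (inA x∈A .proj₁) x≤c)) (≤-<-trans (inA x∈A .proj₂) (inC y∈C)))
  where
  inA : ∀ {x} → x ∈ interval (suc c) e → c < x × x ≤ c + e
  inA x∈ = let c<x , x<end = to ∈-interval⇔ x∈ in c<x , s≤s⁻¹ x<end
  inB : ∀ {x} → x ∈ interval 1 c → x ≤ c
  inB x∈ = s≤s⁻¹ (proj₂ (to ∈-interval⇔ x∈))
  inC : ∀ {x} → x ∈ interval (suc (c + e)) r → c + e < x
  inC x∈ = proj₁ (to ∈-interval⇔ x∈)
  ascending : ∀ {x y} → (x ≤ c → c < y → c + e < y) → x < y → BlockOrdered c (c + e) x y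
  ascending rest x<y = (λ y<x → contradiction y<x (<-asym x<y)) , rest

swapBlocks-alternating : ∀ k c e r → k ∣ c → k ∣ e → AlternatingFrom k 1 (swapBlocks c e r)
swapBlocks-alternating k c e r k∣c k∣e =
  from (AlternatingFrom-++⇔ k 1 (interval (suc c) e))
    (AlternatingFrom-interval k 1 (suc c) e k∣c ,
     from (AlternatingFrom-++⇔ k _ (interval 1 c))
       (AlternatingFrom-interval k _ 1 c (subst (k ∣_) (sym offsetB) k∣e) ,
        AlternatingFrom-interval k _ _ r (subst (k ∣_) (sym offsetC) (k ∣0))))
  where
  lenA = length-interval (suc c) e
  offsetB : ∣ 1 + length (interval (suc c) e) - 1 ∣ ≡ e
  offsetB = trans (cong (λ l → ∣ l - 0 ∣) lenA) (∣-∣-identityʳ e)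
  offsetC : ∣ 1 + length (interval (suc c) e) + length (interval 1 c) - suc (c + e) ∣ ≡ 0
  offsetC = begin
    ∣ length (interval (suc c) e) + length (interval 1 c) - c + e ∣ ≡⟨ cong₂ (λ a b → ∣ a + b - c + e ∣) lenA (length-interval 1 c) ⟩
    ∣ e + c - c + e ∣                                              ≡⟨ cong (λ a → ∣ a - c + e ∣) (+-comm e c) ⟩
    ∣ c + e - c + e ∣                                              ≡⟨ ∣n-n∣≡0 (c + e) ⟩
    0                                                              ∎
    where open ≡-Reasoning

swapBlocks-alternating⁻ : ∀ k c e r → AlternatingFrom k 1 (swapBlocks (suc c) (suc e) r) → k ∣ suc c × k ∣ suc e
swapBlocks-alternating⁻ k c e r alt =
  let (k∣c , _) , altBC = to (AlternatingFrom-++⇔ k 1 (interval (suc (suc c)) (suc e))) alt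
      (k∣e , _) , _     = to (AlternatingFrom-++⇔ k _ (interval 1 (suc c))) altBC
  in k∣c , subst (λ l → k ∣ suc l) (length-interval _ e) k∣e

entriesBefore1 : List ℕ → ℕ
entriesBefore1 []             = 0
entriesBefore1 (suc zero ∷ _) = 0
entriesBefore1 (_ ∷ xs)       = suc (entriesBefore1 xs)

entriesBefore1-++ : All (1 <_) xs → entriesBefore1 (xs ++ ys) ≡ length xs + entriesBefore1 ys
entriesBefore1-++ []                   = refl
entriesBefore1-++ (s≤s (s≤s _) ∷ 1<xs) = cong suc (entriesBefore1-++ 1<xs)

entriesBefore1-swapBlocks : ∀ c e r → entriesBefore1 (swapBlocks (suc c) e r) ≡ e
entriesBefore1-swapBlocks c e r =
  trans (entriesBefore1-++ {xs = interval (suc (suc c)) e} (All.tabulate λ x∈ → ≤-trans (s≤s (s≤s z≤n)) (proj₁ (to ∈-interval⇔ x∈))))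
        (trans (+-identityʳ _) (length-interval _ e))

entriesBefore1-interval : ∀ n → entriesBefore1 (interval 1 n) ≡ 0
entriesBefore1-interval zero    = refl
entriesBefore1-interval (suc n) = refl

swapBlocks-injective : ∀ {c c′ e e′ r r′} → swapBlocks (suc c) (suc e) r ≡ swapBlocks (suc c′) (suc e′) r′ →
  c ≡ c′ × e ≡ e′
swapBlocks-injective {c} {c′} {e} {e′} {r} {r′} eq =
  suc-injective (suc-injective (∷-injectiveˡ eq)) ,
  suc-injective (trans (sym (entriesBefore1-swapBlocks c (suc e) r))
                       (trans (cong entriesBefore1 eq) (entriesBefore1-swapBlocks c′ (suc e′) r′)))

swapBlocks≢interval : ∀ {c e r} n → swapBlocks (suc c) (suc e) r ≢ interval 1 n
swapBlocks≢interval {c} {e} {r} n eq with () ←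
  trans (sym (entriesBefore1-swapBlocks c (suc e) r)) (trans (cong entriesBefore1 eq) (entriesBefore1-interval n))

pairsBelow : ℕ → List (ℕ × ℕ)
pairsBelow zero    = []
pairsBelow (suc m) = map (0 ,′_) (interval 0 m) ++ map (Product.map₁ suc) (pairsBelow m)

∈-pairsBelow⇔ : ∀ m {i j} → (i , j) ∈ pairsBelow m ⇔ suc i + suc j ≤ m
∈-pairsBelow⇔ m = mk⇔ (∈⁻ m) (∈⁺ m)
  where
  ∈⁻ : ∀ m {i j} → (i , j) ∈ pairsBelow m → suc i + suc j ≤ m
  ∈⁻ (suc m) ij∈ with ∈-++⁻ (map (0 ,′_) (interval 0 m)) ij∈
  ... | inj₁ ij∈₀ with _ , j∈ , refl ← ∈-map⁻ (0 ,′_) ij∈₀ = s≤s (proj₂ (to ∈-interval⇔ j∈))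
  ... | inj₂ ij∈₊ with (_ , _) , ij∈′ , refl ← ∈-map⁻ (Product.map₁ suc) ij∈₊ = s≤s (∈⁻ m ij∈′)
  ∈⁺ : ∀ m {i j} → suc i + suc j ≤ m → (i , j) ∈ pairsBelow m
  ∈⁺ (suc m) {zero}  (s≤s j<m) = ∈-++⁺ˡ (∈-map⁺ (0 ,′_) (from ∈-interval⇔ (z≤n , j<m)))
  ∈⁺ (suc m) {suc i} (s≤s le)  = ∈-++⁺ʳ (map (0 ,′_) (interval 0 m)) (∈-map⁺ (Product.map₁ suc) (∈⁺ m le))

length-pairsBelow : ∀ m → length (pairsBelow m) ≡ m C 2
length-pairsBelow zero    = refl
length-pairsBelow (suc m) = begin
  length (map (0 ,′_) (interval 0 m) ++ map (Product.map₁ suc) (pairsBelow m)) ≡⟨ length-++ (map (0 ,′_) (interval 0 m)) ⟩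
  length (map (0 ,′_) (interval 0 m)) + length (map (Product.map₁ suc) (pairsBelow m))
    ≡⟨ cong₂ _+_ (trans (length-map _ (interval 0 m)) (length-interval 0 m))
                 (trans (length-map _ (pairsBelow m)) (length-pairsBelow m)) ⟩
  m + m C 2                                                                    ≡⟨ cong (_+ m C 2) (nC1≡n m) ⟨
  m C 1 + m C 2                                                                ≡⟨ nCk+nC[k+1]≡[n+1]C[k+1] m 1 ⟩
  suc m C 2                                                                    ∎
  where open ≡-Reasoning

pairsBelow-unique : ∀ m → Unique (pairsBelow m)
pairsBelow-unique zero    = []
pairsBelow-unique (suc m) =
  Unique.++⁺ (Unique.map⁺ (cong proj₂) (interval-unique 0 m))
             (Unique.map⁺ (λ { {_ , _} {_ , _} refl → refl }) (pairsBelow-unique m))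
             λ (ij∈₀ , ij∈₊) → let _ , _ , ij≡₀ = ∈-map⁻ _ ij∈₀ ; _ , _ , ij≡₊ = ∈-map⁻ _ ij∈₊
                               in 0≢1+n (trans (sym (cong proj₁ ij≡₀)) (cong proj₁ ij≡₊))

m*k≤k*q+r⇔m≤q : ∀ {m} k q r → r < k → m * k ≤ k * q + r ⇔ m ≤ q
m*k≤k*q+r⇔m≤q {m} k q r r<k = mk⇔
  (λ le → s≤s⁻¹ (*-cancelʳ-< k m (suc q) (<-≤-trans (s≤s le) (begin
     suc (k * q + r) ≡⟨ +-suc (k * q) r ⟨
     k * q + suc r   ≤⟨ +-monoʳ-≤ (k * q) r<k ⟩
     k * q + k       ≡⟨ +-comm (k * q) k ⟩
     k + k * q       ≡⟨ cong (k +_) (*-comm k q) ⟩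
     suc q * k       ∎))))
  (λ m≤q → begin
     m * k       ≤⟨ *-monoˡ-≤ k m≤q ⟩
     q * k       ≡⟨ *-comm q k ⟩
     k * q       ≤⟨ m≤m+n (k * q) r ⟩
     k * q + r   ∎)
  where open ≤-Reasoning

AlternatingAvoider : ℕ → ℕ → List ℕ → Set
AlternatingAvoider k n π =
  π ↭ interval 1 n × AlternatingFrom k 1 π × ¬ Occurs Pattern321 π × ¬ Occurs Pattern132 π

mpList : ℕ → ℕ → List (List ℕ)
mpList n k = filter (λ π → T? (modAltᵇ k π ∧ avoidsᵇ π (3 ∷ 2 ∷ 1 ∷ []) ∧ avoidsᵇ π (1 ∷ 3 ∷ 2 ∷ []))) (perms n)

∈-mpList⇔ : ∀ {π} n k → π ∈ mpList n k ⇔ AlternatingAvoider k n π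
∈-mpList⇔ {π} n k = mk⇔
  (λ π∈ → let π∈perms , t = ∈-filter⁻ _ π∈
              alt , avoids = to T-∧ t
              a321 , a132 = to T-∧ avoids
          in to ∈-perms⇔ π∈perms , to (modAltᵇ⇔ k π) alt ,
             to (avoidsᵇ⇔¬Occurs π 3 2 1 orderIso321⇔) a321 , to (avoidsᵇ⇔¬Occurs π 1 3 2 orderIso132⇔) a132)
  (λ (π↭ , alt , ¬321 , ¬132) → ∈-filter⁺ _ (from ∈-perms⇔ π↭)
     (from T-∧ (from (modAltᵇ⇔ k π) alt , from T-∧
       (from (avoidsᵇ⇔¬Occurs π 3 2 1 orderIso321⇔) ¬321 , from (avoidsᵇ⇔¬Occurs π 1 3 2 orderIso132⇔) ¬132))))

-- (i , j) stands for the block lengths (1 + i) k and (1 + j) k, so blockSwap is injective.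
blockSwap : ℕ → ℕ → ℕ × ℕ → List ℕ
blockSwap k n (i , j) = swapBlocks (suc i * k) (suc j * k) (n ∸ (suc i + suc j) * k)

blockSwap-injective : ∀ k′ n {ij ij′} → blockSwap (suc k′) n ij ≡ blockSwap (suc k′) n ij′ → ij ≡ ij′
blockSwap-injective k′ n {i , j} {i′ , j′} eq =
  let c≡ , e≡ = swapBlocks-injective eq in
  cong₂ _,_ (suc-injective (*-cancelʳ-≡ (suc i) (suc i′) (suc k′) (cong suc c≡)))
            (suc-injective (*-cancelʳ-≡ (suc j) (suc j′) (suc k′) (cong suc e≡)))

candidates : ℕ → ℕ → ℕ → List (List ℕ)
candidates k m n = interval 1 n ∷ map (blockSwap k n) (pairsBelow m)

candidates-unique : ∀ k′ m n → Unique (candidates (suc k′) m n)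
candidates-unique k′ m n =
  All.tabulate (λ π∈ → notIdentity (∈-map⁻ _ π∈)) ∷ Unique.map⁺ (blockSwap-injective k′ n) (pairsBelow-unique m)
  where
  notIdentity : ∀ {π} → ∃[ ij ] (ij ∈ pairsBelow m × π ≡ blockSwap (suc k′) n ij) → interval 1 n ≢ π
  notIdentity (_ , _ , refl) eq = swapBlocks≢interval n (sym eq)

swapBlocks-alternatingAvoider : ∀ {k n} c e r → c + e + r ≡ n → k ∣ c → k ∣ e →
  AlternatingAvoider k n (swapBlocks c e r)
swapBlocks-alternatingAvoider {k} c e r refl k∣c k∣e =
  swapBlocks↭interval c e r , swapBlocks-alternating k c e r k∣c k∣e ,
  blockOrdered⇒¬321 (swapBlocks-blockOrdered c e r) , blockOrdered⇒¬132 (swapBlocks-blockOrdered c e r)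

interval-alternatingAvoider : ∀ k n → AlternatingAvoider k n (interval 1 n)
interval-alternatingAvoider k n =
  ↭-refl , interval-alternating k n ,
  subst (¬_ ∘ Occurs Pattern321) identity (blockOrdered⇒¬321 (swapBlocks-blockOrdered 0 n 0)) ,
  subst (¬_ ∘ Occurs Pattern132) identity (blockOrdered⇒¬132 (swapBlocks-blockOrdered 0 n 0))
  where
  identity : swapBlocks 0 n 0 ≡ interval 1 n
  identity = ++-identityʳ (interval 1 n)

alternatingAvoider⇔candidate : ∀ k′ m l {π} → l < suc k′ →
  AlternatingAvoider (suc k′) (suc k′ * m + l) π ⇔ π ∈ candidates (suc k′) m (suc k′ * m + l)
alternatingAvoider⇔candidate k′ m l l<k = mk⇔ classify realize
  where
  k = suc k′
  n = k * m + l
  blocksFit⇔ : ∀ i j → (suc i + suc j) * k ≤ n ⇔ (i , j) ∈ pairsBelow m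
  blocksFit⇔ i j = ⇔-sym (∈-pairsBelow⇔ m) ⇔-∘ m*k≤k*q+r⇔m≤q k m l l<k
  blocks≡ : ∀ i j → suc i * k + suc j * k ≡ (suc i + suc j) * k
  blocks≡ i j = sym (*-distribʳ-+ k (suc i) (suc j))
  swapped : ∀ i j r → suc i * k + suc j * k + r ≡ n → swapBlocks (suc i * k) (suc j * k) r ∈ candidates k m n
  swapped i j r sum = there (subst (λ r′ → swapBlocks (suc i * k) (suc j * k) r′ ∈ map (blockSwap k n) (pairsBelow m))
                                   (sym r≡) (∈-map⁺ (blockSwap k n) (to (blocksFit⇔ i j) fits)))
    where
    fits : (suc i + suc j) * k ≤ n
    fits = subst (_≤ n) (blocks≡ i j) (≤-trans (m≤m+n _ r) (≤-reflexive sum))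
    r≡ : r ≡ n ∸ (suc i + suc j) * k
    r≡ = trans (sym (m+n∸m≡n (suc i * k + suc j * k) r)) (cong₂ _∸_ sum (blocks≡ i j))
  classify : ∀ {π} → AlternatingAvoider k n π → π ∈ candidates k m n
  classify (π↭ , alt , ¬321 , ¬132) with avoider⇒swapBlocks π↭ ¬321 ¬132
  ... | zero  , e     , r , refl , sum = here (trans (swapBlocks-trivial 0 e r (inj₁ refl)) (cong (interval 1) sum))
  ... | suc c , zero  , r , refl , sum = here (trans (swapBlocks-trivial (suc c) 0 r (inj₂ refl)) (cong (interval 1) sum))
  ... | suc c , suc e , r , refl , sum with swapBlocks-alternating⁻ k c e r alt
  ...   | divides zero () , _
  ...   | divides (suc i) refl , divides zero ()
  ...   | divides (suc i) refl , divides (suc j) refl = swapped i j r sum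
  realize : ∀ {π} → π ∈ candidates k m n → AlternatingAvoider k n π
  realize (here refl) = interval-alternatingAvoider k n
  realize (there π∈) with (i , j) , ij∈ , refl ← ∈-map⁻ (blockSwap k n) π∈ =
    swapBlocks-alternatingAvoider (suc i * k) (suc j * k) (n ∸ (suc i + suc j) * k)
      (trans (cong (_+ (n ∸ (suc i + suc j) * k)) (blocks≡ i j)) (m+[n∸m]≡n (from (blocksFit⇔ i j) ij∈)))
      (n∣m*n (suc i)) (n∣m*n (suc j))

mainTheorem14 : (k m l : ℕ) → 1 ≤ k → l < k →
    mp (3 ∷ 2 ∷ 1 ∷ []) (1 ∷ 3 ∷ 2 ∷ []) (k * m + l) k ≡ m C 2 + 1
mainTheorem14 (suc k′) m l _ l<k = begin
  length (mpList n k)        ≡⟨ ↭-length (Unique∧∼set⇒↭ (Unique.filter⁺ _ (perms-unique n)) (candidates-unique k′ m n)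
                                  (alternatingAvoider⇔candidate k′ m l l<k ⇔-∘ ∈-mpList⇔ n k)) ⟩
  length (candidates k m n)  ≡⟨ cong suc (trans (length-map (blockSwap k n) (pairsBelow m)) (length-pairsBelow m)) ⟩
  suc (m C 2)                ≡⟨ +-comm 1 (m C 2) ⟩
  m C 2 + 1                  ∎
  where
  k = suc k′
  n = k * m + l
  open ≡-Reasoning
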